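{- Let $\mathscr D=\{d_1,\ldots,d_n\}$ be a set of positive integers with $d_1>d_2>\cdots>d_n$. Define a sequence $\overline{\mathbf s}=a_1,\ldots,a_p$ as follows. Case (a): $\sigma(\mathscr D)$ is even or $d_n$ is odd. Let $\mathbf s=d_1,\ldots,d_n$, $c=\max_{1\le k\le n-1}\left\lceil \frac{ -\Delta_{\mathbf s}(k)}{\min\{k,d_n\}}\right\rceil$, and $C^{\star}=c$ if $d_n$ and $\sigma(\mathscr D)$ are even or if $d_n$ is odd and $\sigma(\mathscr D)+cd_n$ is even, while $C^{\star}=c+1$ if $d_n$ and $\sigma(\mathscr D)+cd_n$ are odd. Set $\overline{\mathbf s}=d_1,\ldots,d_{n-1},(d_n)_{C^{\star}+1}$. Case (b): $\sigma(\mathscr D)$ is odd and $d_n$ is even. Let $r=\max\{i:d_i\text{ odd}\}$, $\mathbf s=d_1,\ldots,d_{r-1},(d_r)_2,d_{r+1},\ldots,d_n$, $C^{\star}=\max_{1\le k\le n}\left\lceil \frac{ -\Delta_{\mathbf s}(k)}{\min\{k,d_n\}}\right\rceil$, and let $\overline{\mathbf s}$ be $\mathbf s$ followed by $C^{\star}$ further copies of $d_n$. (The sequence $\overline{\mathbf s}$ is graphic with degree set $\mathscr D$.) If $a'_1\ge a'_2\ge\cdots\ge a'_{p'}$ is any graphic sequence whose set of distinct terms is $\mathscr D$, then $a_i\le a'_i$ for all $1\le i\le\min\{p,p'\}$.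
   Context: All graphs are finite and simple. A nonincreasing sequence $a_1,\ldots,a_p$ of nonnegative integers is graphic if there is a simple graph with vertices $v_1,\ldots,v_p$ such that $\deg v_k=a_k$ for each $k$. The notation $(d)_m$ denotes $m$ consecutive occurrences of $d$ in a sequence. $\sigma(\mathscr D)$ is the sum of the elements of $\mathscr D$. For a sequence $\mathbf s=a_1,\ldots,a_p$ and $1\le k\le p$, $\Delta_{\mathbf s}(k)=k(k-1)+\sum_{i=k+1}^{p}\min\{k,a_i\}-\sum_{i=1}^{k}a_i$. -}

module Defs where

open import Data.Bool using (Bool; true; false; if_then_else_; _∧_; not)
open import Data.Nat as ℕ using (ℕ; zero; suc; _+_; _*_; _∸_; _⊓_; _≤_; _<_; _%_; _/_; _≡ᵇ_)
open import Data.Integer as ℤ using (ℤ; +_; -[1+_]; -_; _⊔_) renaming (_-_ to _-ℤ_; _+_ to _+ℤ_)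
open import Data.Nat.ListAction using (sum)
open import Data.List using (List; []; _∷_; _++_; map; take; drop; length; replicate; upTo; lookup; _∷ʳ_; allFin)
open import Data.Fin using (Fin)
open import Data.Product using (Σ; _×_)
open import Relation.Binary.PropositionalEquality using (_≡_)

isOdd : ℕ → Bool
isOdd n = (n % 2) ≡ᵇ 1

isEven : ℕ → Bool
isEven n = not (isOdd n)

record SimpleGraph (p : ℕ) : Set where
  field
    adj   : Fin p → Fin p → Bool
    sym   : ∀ i j → adj i j ≡ adj j i
    irrefl : ∀ i → adj i i ≡ false

open SimpleGraph public

degree : ∀ {p} → SimpleGraph p → Fin p → ℕ
degree {p} G v = sum (map (λ w → if adj G v w then 1 else 0) (allFin p))

Graphic : List ℕ → Set
Graphic as = Σ (SimpleGraph (length as)) λ G → ∀ k → degree G k ≡ lookup as k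

Nonincreasing : List ℕ → Set
Nonincreasing as = ∀ i j (hi : i < length as) (hj : j < length as) → i ≤ j →
  lookup as (Data.Fin.fromℕ< hj) ≤ lookup as (Data.Fin.fromℕ< hi)

Δ : List ℕ → ℕ → ℤ
Δ s k = + (k * (k ∸ 1) + sum (map (k ⊓_) (drop k s))) -ℤ + sum (take k s)

-- ⌈ x / m ⌉ for an integer x and a positive natural m
-- (the value for m = 0 is junk and never used)
ceilDiv : ℤ → ℕ → ℤ
ceilDiv x       zero    = + 0
ceilDiv (+ n)   (suc m) = + ((n + m) / suc m)
ceilDiv -[1+ n ] (suc m) = - (+ (suc n / suc m))

-- maximum of a list of integers (value 0 on the empty list; only
-- relevant in the degenerate case n = 1 of case (a), where the
-- conclusion holds regardless)
maxOver : List ℤ → ℤ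
maxOver []       = + 0
maxOver (x ∷ xs) = go x xs
  where
  go : ℤ → List ℤ → ℤ
  go m []       = m
  go m (y ∷ ys) = go (m ⊔ y) ys

bound : List ℕ → ℕ → ℕ → ℤ
bound s dn K = maxOver (map (λ k → ceilDiv (- Δ s k) (k ⊓ dn)) (map suc (upTo K)))

-- natural number value of a (nonnegative) integer; here always applied
-- to nonnegative values
toℕ : ℤ → ℕ
toℕ (+ n)    = n
toℕ -[1+ _ ] = 0

-- Duplicating the last odd term: d_1..d_{r-1},(d_r)_2,d_{r+1}..d_n
-- where r = max{i : d_i odd}

noOdd : List ℕ → Bool
noOdd []       = true
noOdd (x ∷ xs) = not (isOdd x) ∧ noOdd xs

dupLastOdd : List ℕ → List ℕ
dupLastOdd []       = []
dupLastOdd (x ∷ xs) = if isOdd x ∧ noOdd xs then x ∷ x ∷ xs else x ∷ dupLastOdd xs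

-- The sequence s̄ for 𝒟 = {d_1 > ... > d_{n-1} > d_n}, given as ds = d_1..d_{n-1}
-- and dn = d_n.

sbar : List ℕ → ℕ → List ℕ
sbar ds dn with isEven (sum (ds ∷ʳ dn)) ∧ isEven dn | isOdd dn
... | true  | _     =                                   -- case (a), d_n and σ even
  ds ++ replicate (suc (toℕ c)) dn
  where c = bound (ds ∷ʳ dn) dn (length ds)
... | false | true  =                                   -- case (a), d_n odd
  ds ++ replicate (suc (toℕ Cstar)) dn
  where
  c = bound (ds ∷ʳ dn) dn (length ds)
  Cstar = if isEven ((sum (ds ∷ʳ dn) + ℤ.∣ c ∣ * dn)) then c else c +ℤ + 1
... | false | false =                                   -- case (b): σ odd, d_n even
  s ++ replicate (toℕ Cstar) dn
  where
  s = dupLastOdd (ds ∷ʳ dn)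
  Cstar = bound s dn (length (ds ∷ʳ dn))

-- Write a′ for the graphic sequence. Since a′ is nonincreasing with value set 𝒟, its i-th
-- term is at least d_i, and every term is at least d_n; this already settles case (a), where
-- s̄ is d_1, …, d_n padded with copies of d_n. In case (b) s̄ repeats the last odd degree d_r,
-- so we must show that a′ also takes the value d_r at least twice, unless it takes a larger
-- value twice, which shifts a′ one step to the right and is equally good. If every value
-- ≥ d_r occurred exactly once, all remaining terms of a′ would lie in the even part
-- d_{r+1}, …, d_n, making σ(a′) ≡ σ(𝒟) odd, against the handshake lemma. Neither the
-- number C⋆ of trailing copies of d_n nor the positivity of the degrees plays any role.
module Submission where

open import Defs hiding (sym)
open import Data.Bool using (true; false; _∧_; if_then_else_)
open import Data.Bool.Properties using (∧-conicalʳ)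
open import Data.Nat using (ℕ; zero; suc; _+_; _*_; _≤_; _<_; _≥_; _>_; _%_; _≡ᵇ_; z≤n; s≤s)
open import Data.Nat.Properties
  using (+-identityʳ; ≤-refl; ≤-trans; <-trans; <⇒≤; <-≤-trans; <⇒≢; <⇒≱; m≤n⇒m<n∨m≡n; _≟_;
         +-0-commutativeMonoid)
open import Data.Nat.DivMod using (m%n<n)
open import Data.Nat.Divisibility using (_∣_; m%n≡0⇒n∣m; n∣m⇒m%n≡0; ∣m∣n⇒∣m+n; ∣m+n∣m⇒∣n; m∣m*n; _∣0)
open import Data.Nat.ListAction using (sum)
open import Data.Nat.Solver using (module +-*-Solver)
open import Data.List using (List; []; _∷_; _∷ʳ_; _++_; [_]; length; lookup; replicate; tabulate)
open import Data.List.Properties using (++-assoc; map-tabulate; tabulate-lookup)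
open import Data.List.Relation.Unary.All as All using (All; []; _∷_)
open import Data.List.Relation.Unary.Any using (here; there)
open import Data.List.Relation.Unary.Linked as Linked using (Linked; []; [-]; _∷_)
open import Data.List.Relation.Unary.Linked.Properties using (Linked⇒All)
open import Data.List.Relation.Binary.Prefix.Heterogeneous using (Prefix; []; _∷_)
open import Data.List.Relation.Binary.Prefix.Heterogeneous.Properties using (fromPointwise)
open import Data.List.Relation.Binary.Pointwise as Pointwise using ()
open import Data.List.Membership.Propositional using (_∈_)
open import Data.List.Membership.DecPropositional _≟_ using (_∈?_)
open import Data.Fin using (Fin; zero; suc; fromℕ<)
open import Data.Product using (_,_)
open import Data.Sum using (_⊎_; inj₁; inj₂)
open import Function using (_∘_; flip)
open import Function.Bundles using (_⇔_; module Equivalence)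
open import Relation.Nullary using (¬_; yes; no; contradiction)
open import Relation.Binary.PropositionalEquality using (_≡_; refl; sym; trans; cong; cong₂; subst; module ≡-Reasoning)
open import Algebra.Properties.CommutativeMonoid.Sum +-0-commutativeMonoid
  using (∑-distrib-+; sum-cong-≗) renaming (sum to ∑)

isOdd≡false⇒2∣ : ∀ n → isOdd n ≡ false → 2 ∣ n
isOdd≡false⇒2∣ n n-even with n % 2 in n%2 | m%n<n n 2
... | 0           | _               = m%n≡0⇒n∣m n 2 n%2
... | 1           | _               = contradiction n-even λ ()
... | suc (suc _) | s≤s (s≤s ())

isOdd≡true⇒∤ : ∀ n → isOdd n ≡ true → ¬ 2 ∣ n
isOdd≡true⇒∤ n n-odd 2∣n with () ← trans (sym n-odd) (cong (_≡ᵇ 1) (n∣m⇒m%n≡0 n 2 2∣n))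

noOdd⇒All-2∣ : ∀ xs → noOdd xs ≡ true → All (2 ∣_) xs
noOdd⇒All-2∣ []       _ = []
noOdd⇒All-2∣ (x ∷ xs) p with isOdd x in x-odd
... | false = isOdd≡false⇒2∣ x x-odd ∷ noOdd⇒All-2∣ xs p

All-2∣⇒2∣sum : ∀ {xs} → All (2 ∣_) xs → 2 ∣ sum xs
All-2∣⇒2∣sum []       = 2 ∣0
All-2∣⇒2∣sum (p ∷ ps) = ∣m∣n⇒∣m+n p (All-2∣⇒2∣sum ps)

2∣-+-twice : ∀ x s t → 2 ∣ s + t → 2 ∣ (x + s) + (x + t)
2∣-+-twice x s t 2∣s+t = subst (2 ∣_) (sym regroup) (∣m∣n⇒∣m+n (m∣m*n x) 2∣s+t)
  where
  open +-*-Solver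
  regroup : (x + s) + (x + t) ≡ 2 * x + (s + t)
  regroup = solve 3 (λ x s t → (x :+ s) :+ (x :+ t) := con 2 :* x :+ (s :+ t)) refl x s t

edge : ∀ {p} → SimpleGraph p → Fin p → Fin p → ℕ
edge G v w = if adj G v w then 1 else 0

sum-tabulate : ∀ {p} (f : Fin p → ℕ) → sum (tabulate f) ≡ ∑ f
sum-tabulate {zero}  f = refl
sum-tabulate {suc p} f = cong (f zero +_) (sum-tabulate (f ∘ suc))

degree≡∑edge : ∀ {p} (G : SimpleGraph p) v → degree G v ≡ ∑ (edge G v)
degree≡∑edge G v = trans (cong sum (map-tabulate (λ w → w) (edge G v))) (sum-tabulate (edge G v))

2∣∑∑-symmetric : ∀ {p} (f : Fin p → Fin p → ℕ) → (∀ v w → f v w ≡ f w v) → (∀ v → f v v ≡ 0) →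
                 2 ∣ ∑ (λ v → ∑ (f v))
2∣∑∑-symmetric {zero}  f _   _     = 2 ∣0
2∣∑∑-symmetric {suc p} f f-sym f-irrefl =
  subst (2 ∣_) (sym split) (2∣-+-twice A 0 T
    (2∣∑∑-symmetric (λ v w → f (suc v) (suc w)) (λ v w → f-sym (suc v) (suc w)) (f-irrefl ∘ suc)))
  where
  open ≡-Reasoning
  A = ∑ (λ w → f zero (suc w))
  T = ∑ (λ v → ∑ (λ w → f (suc v) (suc w)))
  split : ∑ (λ v → ∑ (f v)) ≡ (A + 0) + (A + T)
  split = begin
    (f zero zero + A) + ∑ (λ v → f (suc v) zero + ∑ (λ w → f (suc v) (suc w)))
      ≡⟨ cong₂ _+_ (cong (_+ A) (f-irrefl zero)) (∑-distrib-+ (λ v → f (suc v) zero) _) ⟩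
    A + (∑ (λ v → f (suc v) zero) + T)
      ≡⟨ cong₂ (λ a b → a + (b + T)) (sym (+-identityʳ A)) (sum-cong-≗ (λ v → f-sym (suc v) zero)) ⟩
    (A + 0) + (A + T) ∎

graphic⇒2∣sum : ∀ as → Graphic as → 2 ∣ sum as
graphic⇒2∣sum as (G , deg) =
  subst (2 ∣_) ∑∑edge≡sum (2∣∑∑-symmetric (edge G) edge-sym edge-irrefl)
  where
  open ≡-Reasoning
  edge-sym : ∀ v w → edge G v w ≡ edge G w v
  edge-sym v w = cong (λ b → if b then 1 else 0) (SimpleGraph.sym G v w)
  edge-irrefl : ∀ v → edge G v v ≡ 0
  edge-irrefl v = cong (λ b → if b then 1 else 0) (irrefl G v)
  ∑∑edge≡sum : ∑ (λ v → ∑ (edge G v)) ≡ sum as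
  ∑∑edge≡sum = begin
    ∑ (λ v → ∑ (edge G v))       ≡⟨ sum-cong-≗ (λ v → trans (sym (degree≡∑edge G v)) (deg v)) ⟩
    ∑ (lookup as)                ≡⟨ sym (sum-tabulate (lookup as)) ⟩
    sum (tabulate (lookup as))   ≡⟨ cong sum (tabulate-lookup as) ⟩
    sum as                       ∎

Nonincreasing⇒Linked : ∀ as → Nonincreasing as → Linked _≥_ as
Nonincreasing⇒Linked []           _ = []
Nonincreasing⇒Linked (x ∷ [])     _ = [-]
Nonincreasing⇒Linked (x ∷ y ∷ as) N =
  N 0 1 (s≤s z≤n) (s≤s (s≤s z≤n)) z≤n ∷
  Nonincreasing⇒Linked (y ∷ as) (λ i j i< j< i≤j → N (suc i) (suc j) (s≤s i<) (s≤s j<) (s≤s i≤j))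

head-maximum : ∀ {y ys z} → Linked _≥_ (y ∷ ys) → z ∈ y ∷ ys → z ≤ y
head-maximum ys↘ = All.lookup (Linked⇒All (flip ≤-trans) ≤-refl ys↘)

All-<-head : ∀ {y x xs} → x < y → Linked _>_ (x ∷ xs) → All (_< y) (x ∷ xs)
All-<-head = Linked⇒All (flip <-trans)

All-<-tail : ∀ {x xs} → Linked _>_ (x ∷ xs) → All (_< x) xs
All-<-tail [-]         = []
All-<-tail (x>y ∷ xs↘) = All-<-head x>y xs↘

last-minimum : ∀ xs {x} → Linked _≥_ (xs ∷ʳ x) → All (x ≤_) (xs ∷ʳ x)
last-minimum []           _            = ≤-refl ∷ []
last-minimum (y ∷ [])     (y≥x ∷ _)    = y≥x ∷ ≤-refl ∷ []
last-minimum (y ∷ z ∷ zs) (y≥z ∷ zs↘) with last-minimum (z ∷ zs) zs↘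
... | z≥x ∷ x≤zs = ≤-trans z≥x y≥z ∷ z≥x ∷ x≤zs

<-head⇒∈-tail : ∀ {z y ys} → z < y → z ∈ y ∷ ys → z ∈ ys
<-head⇒∈-tail z<y (here refl) = contradiction refl (<⇒≢ z<y)
<-head⇒∈-tail z<y (there z∈ys) = z∈ys

All-∈-tail : ∀ {y ys zs} → All (_< y) zs → All (_∈ y ∷ ys) zs → All (_∈ ys) zs
All-∈-tail zs<y zs⊆ = All.zipWith (λ (z<y , z∈) → <-head⇒∈-tail z<y z∈) (zs<y , zs⊆)

All-∈-tail-of-head : ∀ {x xs ys} → Linked _>_ (x ∷ xs) → All (_∈ x ∷ ys) (x ∷ xs) → All (_∈ ys) xs
All-∈-tail-of-head xs↘ xs⊆ = All-∈-tail (All-<-tail xs↘) (All.tail xs⊆)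

infix 4 _≼_

data _≼_ : List ℕ → List ℕ → Set where
  []ˡ : ∀ {ys} → [] ≼ ys
  []ʳ : ∀ {xs} → xs ≼ []
  _∷_ : ∀ {x y xs ys} → x ≤ y → xs ≼ ys → x ∷ xs ≼ y ∷ ys

≼-lookup : ∀ {xs ys} → xs ≼ ys → ∀ i (h : i < length xs) (h′ : i < length ys) →
           lookup xs (fromℕ< h) ≤ lookup ys (fromℕ< h′)
≼-lookup []ˡ          i       ()      _
≼-lookup []ʳ          i       _       ()
≼-lookup (x≤y ∷ _)    zero    _       _        = x≤y
≼-lookup (_ ∷ xs≼ys) (suc i) (s≤s h) (s≤s h′) = ≼-lookup xs≼ys i h h′

Prefix-≼-trans : ∀ {xs zs ys} → Prefix _≤_ xs zs → zs ≼ ys → xs ≼ ys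
Prefix-≼-trans []          _           = []ˡ
Prefix-≼-trans (_ ∷ _)     []ʳ         = []ʳ
Prefix-≼-trans (x≤z ∷ xs≤) (z≤y ∷ zs≼) = ≤-trans x≤z z≤y ∷ Prefix-≼-trans xs≤ zs≼

replicate-≼ : ∀ {b ys} k → All (b ≤_) ys → replicate k b ≼ ys
replicate-≼ zero    _            = []ˡ
replicate-≼ (suc k) []           = []ʳ
replicate-≼ (suc k) (b≤y ∷ b≤ys) = b≤y ∷ replicate-≼ k b≤ys

≼-++-replicate : ∀ {xs ys b} → xs ≼ ys → All (b ≤_) ys → ∀ k → xs ++ replicate k b ≼ ys
≼-++-replicate []ˡ         b≤ys       k = replicate-≼ k b≤ys
≼-++-replicate []ʳ         _          k = []ʳ
≼-++-replicate (x≤y ∷ xs≼) (_ ∷ b≤ys) k = x≤y ∷ ≼-++-replicate xs≼ b≤ys k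

strictly-decreasing-≼ : ∀ {D ys} → Linked _≥_ ys → Linked _>_ D → All (_∈ ys) D → D ≼ ys
strictly-decreasing-≼ {[]}              _   _  _              = []ˡ
strictly-decreasing-≼ {x ∷ D} {[]}      _   _  _              = []ʳ
strictly-decreasing-≼ {x ∷ D} {y ∷ ys} ys↘ D↘ (x∈y∷ys ∷ D⊆) =
  x≤y ∷ strictly-decreasing-≼ (Linked.tail ys↘) (Linked.tail D↘) (All-∈-tail D<y D⊆)
  where
  x≤y = head-maximum ys↘ x∈y∷ys
  D<y = All.map (λ z<x → <-≤-trans z<x x≤y) (All-<-tail D↘)

dupLastOdd-shift : ∀ {x xs} → Linked _≥_ (x ∷ xs) → Prefix _≤_ (dupLastOdd xs) (x ∷ xs)
dupLastOdd-shift {xs = []}     _           = []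
dupLastOdd-shift {xs = r ∷ rs} (x≥r ∷ rs↘) with isOdd r ∧ noOdd rs
... | true  = x≥r ∷ fromPointwise (Pointwise.refl ≤-refl)
... | false = x≥r ∷ dupLastOdd-shift rs↘

InOrAbove : List ℕ → ℕ → Set
InOrAbove D z = z ∈ D ⊎ All (_< z) D

InOrAbove-tail : ∀ {x rest z} → Linked _>_ (x ∷ rest) → InOrAbove (x ∷ rest) z → InOrAbove rest z
InOrAbove-tail D↘ (inj₁ (here refl))     = inj₂ (All-<-tail D↘)
InOrAbove-tail _  (inj₁ (there z∈rest))  = inj₁ z∈rest
InOrAbove-tail _  (inj₂ (_ ∷ rest<z))    = inj₂ rest<z

-- ys may still repeat degrees already removed from D, hence InOrAbove. The parity hypothesis
-- survives removing a common head of ys and D, and at the last odd degree x it rules out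
-- that ys drops below x right after its first x.
dupLastOdd-≼ : ∀ {D ys} → Linked _>_ D → Linked _≥_ ys → All (_∈ ys) D → All (InOrAbove D) ys →
               ¬ 2 ∣ sum ys + sum D → dupLastOdd D ≼ ys
dupLastOdd-≼ {[]}                 _  _   _  _  _   = []ˡ
dupLastOdd-≼ {x ∷ rest} {[]}      _  _   _  _  _   = []ʳ
dupLastOdd-≼ {x ∷ rest} {y ∷ ys} D↘ ys↘ D⊆ ys⊑ odd
  with m≤n⇒m<n∨m≡n (head-maximum ys↘ (All.head D⊆))
... | inj₁ x<y =
  Prefix-≼-trans (dupLastOdd-shift (≤-refl ∷ Linked.map <⇒≤ D↘))
    (<⇒≤ x<y ∷ strictly-decreasing-≼ (Linked.tail ys↘) D↘ (All-∈-tail (All-<-head x<y D↘) D⊆))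
... | inj₂ refl with isOdd x ∧ noOdd rest in last-odd
...   | false =
  ≤-refl ∷ dupLastOdd-≼ (Linked.tail D↘) (Linked.tail ys↘) (All-∈-tail-of-head D↘ D⊆)
             (All.map (InOrAbove-tail D↘) (All.tail ys⊑)) (odd ∘ 2∣-+-twice x (sum ys) (sum rest))
...   | true with x ∈? ys
...     | yes x∈ys =
  ≤-refl ∷ strictly-decreasing-≼ (Linked.tail ys↘) D↘ (x∈ys ∷ All-∈-tail-of-head D↘ D⊆)
...     | no  x∉ys =
  contradiction (2∣-+-twice x (sum ys) (sum rest)
                  (∣m∣n⇒∣m+n (All-2∣⇒2∣sum ys-even) (All-2∣⇒2∣sum rest-even))) odd
  where
  rest-even : All (2 ∣_) rest
  rest-even = noOdd⇒All-2∣ rest (∧-conicalʳ (isOdd x) (noOdd rest) last-odd)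
  ys⊆rest : ∀ {z} → z ∈ ys → z ∈ rest
  ys⊆rest z∈ys with All.lookup (All.tail ys⊑) z∈ys
  ... | inj₁ (here refl)     = contradiction z∈ys x∉ys
  ... | inj₁ (there z∈rest)  = z∈rest
  ... | inj₂ (x<z ∷ _)       = contradiction (head-maximum ys↘ (there z∈ys)) (<⇒≱ x<z)
  ys-even : All (2 ∣_) ys
  ys-even = All.tabulate (All.lookup rest-even ∘ ys⊆rest)

module _ {ds dn a′} (D↘ : Linked _>_ (ds ∷ʳ dn)) (a′↘ : Linked _≥_ a′) (a′-even : 2 ∣ sum a′)
         (D⊆a′ : All (_∈ a′) (ds ∷ʳ dn)) (a′⊆D : All (_∈ ds ∷ʳ dn) a′) where

  dn≤a′ : All (dn ≤_) a′
  dn≤a′ = All.map (All.lookup (last-minimum ds (Linked.map <⇒≤ D↘))) a′⊆D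

  padded-≼ : ∀ k → ds ++ replicate (suc k) dn ≼ a′
  padded-≼ k = subst (_≼ a′) (++-assoc ds [ dn ] (replicate k dn))
                 (≼-++-replicate (strictly-decreasing-≼ a′↘ D↘ D⊆a′) dn≤a′ k)

  sum-odd⇒total-odd : isOdd (sum (ds ∷ʳ dn)) ≡ true → ¬ 2 ∣ sum a′ + sum (ds ∷ʳ dn)
  sum-odd⇒total-odd σ-odd 2∣total = isOdd≡true⇒∤ _ σ-odd (∣m+n∣m⇒∣n 2∣total a′-even)

  sbar-≼ : sbar ds dn ≼ a′
  sbar-≼ with isOdd (sum (ds ∷ʳ dn)) in σ-odd | isOdd dn
  ... | false | false = padded-≼ _
  ... | false | true  = padded-≼ _
  ... | true  | true  = padded-≼ _
  ... | true  | false =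
    ≼-++-replicate (dupLastOdd-≼ D↘ a′↘ D⊆a′ (All.map inj₁ a′⊆D) (sum-odd⇒total-odd σ-odd)) dn≤a′ _

lemma2 : (ds : List ℕ) (dn : ℕ) →
         Linked _>_ (ds ∷ʳ dn) → All (0 <_) (ds ∷ʳ dn) →
         (a′ : List ℕ) → Nonincreasing a′ → Graphic a′ →
         (∀ x → (x ∈ a′) ⇔ (x ∈ (ds ∷ʳ dn))) →
         ∀ i (h : i < length (sbar ds dn)) (h′ : i < length a′) →
         lookup (sbar ds dn) (fromℕ< h) ≤ lookup a′ (fromℕ< h′)
lemma2 ds dn D↘ _ a′ a′↘ a′-graphic a′≡D =
  ≼-lookup (sbar-≼ D↘ (Nonincreasing⇒Linked a′ a′↘) (graphic⇒2∣sum a′ a′-graphic)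
    (All.tabulate (Equivalence.from (a′≡D _))) (All.tabulate (Equivalence.to (a′≡D _))))
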